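{- Consider the Round-Robin protocol with $n\ge 2$ agents over a finite item set $M$, as described in the context. Let $i\in[n]$ be an agent whose objective $f_i$ is normalized, nonnegative, monotone and submodular, and whose constraint is a cardinality constraint $\mathcal{I}_i=\{S\subseteq M: |S|\le k\}$ for some integer $k\ge 1$. If agent $i$ follows the greedy policy (other agents following arbitrary policies), then the set $S_i$ it builds satisfies $f_i(S_i)\ge \mathrm{OPT}^-_i/n$.
   Context: For $f:2^M\to\mathbb{R}$ write $f(x\,|\,S)=f(S\cup\{x\})-f(S)$; $f$ is submodular if $f(x\,|\,S)\ge f(x\,|\,T)$ whenever $S\subseteq T\subseteq M$, $x\notin T$. Round-Robin protocol: $|M|=m$; initially the available set is $Q=M$; for rounds $r=1,\dots,\lceil m/n\rceil$ and within each round for agents $1,\dots,n$ in order, the current agent (by an arbitrary policy possibly using full information) either selects one item of $Q$, which is removed from $Q$, or selects nothing. Greedy policy of agent $i$: maintain $S_i$ (initially $\emptyset$); at each turn let $A=\{x\in Q: S_i\cup\{x\}\in\mathcal{I}_i\}$; if $A\neq\emptyset$ select some $j\in\arg\max_{x\in A}f_i(x\,|\,S_i)$ and add it to $S_i$, otherwise select nothing. $M_i$ is the set of items still available right before agent $i$'s first turn, and $\mathrm{OPT}^-_i=\max\{f_i(S):S\in\mathcal{I}_i, S\subseteq M_i\}$.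
   Formalization: The objective $f_i$ takes only rational values instead of real ones. -}

module Defs where

open import Data.Nat as ℕ using (ℕ; zero; suc; _+_; _∸_; _<_; _/_; _%_)
open import Data.Fin using (Fin; toℕ)
open import Data.Fin.Subset using (Subset; ⊤; ⊥; ⁅_⁆; _∪_; _∈_; _∉_; _⊆_; _-_; ∣_∣)
open import Data.Maybe using (Maybe; just; nothing)
open import Data.Product using (_×_; Σ; ∃)
open import Data.Sum using (_⊎_)
open import Data.Rational as ℚ using (ℚ; 0ℚ)
open import Relation.Binary.PropositionalEquality using (_≡_)
import Data.Integer
open import Relation.Nullary using (¬_; yes; no)

SetFun : ℕ → Set
SetFun m = Subset m → ℚ

marg : ∀ {m} → SetFun m → Fin m → Subset m → ℚ
marg f x S = f (S ∪ ⁅ x ⁆) ℚ.- f S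

Normalized : ∀ {m} → SetFun m → Set
Normalized f = f ⊥ ≡ 0ℚ

Nonnegative : ∀ {m} → SetFun m → Set
Nonnegative {m} f = (S : Subset m) → 0ℚ ℚ.≤ f S

Monotone : ∀ {m} → SetFun m → Set
Monotone {m} f = (S T : Subset m) → S ⊆ T → f S ℚ.≤ f T

Submodular : ∀ {m} → SetFun m → Set
Submodular {m} f = (S T : Subset m) (x : Fin m) → S ⊆ T → x ∉ T →
  marg f x T ℚ.≤ marg f x S

ceilDiv : ℕ → ℕ → ℕ
ceilDiv m zero = zero
ceilDiv m (suc n) = (m + n) / suc n

numTurns : (m n : ℕ) → ℕ
numTurns m n = ceilDiv m n ℕ.* n

-- turns are numbered 0,1,2,...; turn t belongs to agent (t mod n)
-- (agents are numbered 0,...,n-1, i.e. agent j+1 of the paper is index j)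
turnAgent : (n : ℕ) → ℕ → ℕ
turnAgent zero t = zero
turnAgent (suc n) t = t % suc n

-- An execution records what is selected at each turn (nothing = select nothing).
Choices : ℕ → Set
Choices m = ℕ → Maybe (Fin m)

removeChoice : ∀ {m} → Maybe (Fin m) → Subset m → Subset m
removeChoice nothing  Q = Q
removeChoice (just x) Q = Q - x

avail : ∀ {m} → Choices m → ℕ → Subset m
avail c zero = ⊤
avail c (suc t) = removeChoice (c t) (avail c t)

addChoice : ∀ {m} → Maybe (Fin m) → Subset m → Subset m
addChoice nothing  S = S
addChoice (just x) S = S ∪ ⁅ x ⁆

bundle : ∀ {m} → (n : ℕ) → Choices m → ℕ → ℕ → Subset m
bundle n c a zero = ⊥
bundle n c a (suc t) with turnAgent n t ℕ.≟ a
... | yes _ = addChoice (c t) (bundle n c a t)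
... | no  _ = bundle n c a t

-- Validity of an execution of the protocol: whatever policies are used,
-- each selected item is available at the time it is selected.
ValidRun : ∀ {m} → (n : ℕ) → Choices m → Set
ValidRun {m} n c = (t : ℕ) (x : Fin m) → t < numTurns m n → c t ≡ just x → x ∈ avail c t

Feasible : ∀ {m} → ℕ → Subset m → Subset m → Fin m → Set
Feasible k S Q x = x ∈ Q × ∣ S ∪ ⁅ x ⁆ ∣ ℕ.≤ k

GreedyStep : ∀ {m} → SetFun m → ℕ → Subset m → Subset m → Maybe (Fin m) → Set
GreedyStep {m} f k S Q choice =
    (((x : Fin m) → ¬ Feasible k S Q x) × choice ≡ nothing)
  ⊎ (Σ (Fin m) λ j → choice ≡ just j × Feasible k S Q j ×
       ((x : Fin m) → Feasible k S Q x → marg f x S ℚ.≤ marg f j S))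

FollowsGreedy : ∀ {m} → (n : ℕ) → SetFun m → ℕ → Choices m → ℕ → Set
FollowsGreedy {m} n f k c a = (t : ℕ) → t < numTurns m n → turnAgent n t ≡ a →
  GreedyStep f k (bundle n c a t) (avail c t) (c t)

-- OPT⁻ / n ≤ value, written out: every feasible S ⊆ M_i has f S ≤ n · value
-- (equivalently, max {f S : |S| ≤ k, S ⊆ M_i} / n ≤ value)
OptMinusBound : ∀ {m} → SetFun m → ℕ → Subset m → ℕ → ℚ → Set
OptMinusBound {m} f k Mi n v = (S : Subset m) → ∣ S ∣ ℕ.≤ k → S ⊆ Mi →
  f S ℚ.≤ (Data.Integer.+ n ℚ./ 1) ℚ.* v

{-# OPTIONS --safe #-}
-- Let T be the agent's final bundle, and S r, Q r its bundle and the available items just before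
-- its r-th turn. Going backwards over r one shows: every O ⊆ Q r disjoint from T with
-- |O| ≤ (n-1)(|T| - |S r|) has f (T ∪ O) ≤ f T + (n-1)(f T - f (S r)). At its own turn the agent
-- picks some g ∈ T, so O stays available; each of the n-1 turns of other agents that follow removes
-- at most one item y of O, and putting y back costs at most the greedy gain f (S r ∪ {g}) - f (S r),
-- because y was a feasible candidate and f is submodular. These n-1 costs are paid for by the
-- growth of (n-1) f (S r) over the round. For r = 0 and O ⊆ M_i with |O| ≤ k, the set O ∖ T fits the
-- budget (n-1)|T|: clearly if |T| ≥ k; otherwise the agent picked at every turn, so |T| = ⌈m/n⌉
-- and |O ∖ T| ≤ m - |T| ≤ (n-1)|T|, unless the items ran out, in which case no budget is needed.
-- Hence f O ≤ f (T ∪ (O ∖ T)) ≤ n f T.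
module Submission where

open import Defs
open import Data.Nat using (ℕ; _≤_)
open import Data.Fin using (Fin; toℕ)

open import Data.Bool using (true; false)
open import Data.Empty using (⊥-elim)
import Data.Fin as 𝔽
open import Data.Fin.Properties using (toℕ<n)
open import Data.Fin.Subset
open import Data.Fin.Subset.Properties
import Data.Integer as ℤ
import Data.Integer.Properties as ℤP
open import Data.Maybe using (Maybe; just; nothing)
open import Data.Nat as ℕ using (zero; suc; _+_; _*_; _∸_; _<_; _≤′_; ≤′-refl; ≤′-step; z≤n; s≤s; NonZero)
import Data.Nat.Properties as ℕP
open import Data.Nat.Coprimality using (1-coprimeTo) renaming (sym to coprime-sym)
open import Data.Nat.DivMod using (_%_; _/_; m≡m%n+[m/n]*n; [m+kn]%n≡m%n; m<n⇒m%n≡m; m*n%n≡0; m%n<n)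
open import Data.Product using (_×_; _,_; ∃-syntax)
open import Data.Rational as ℚ using (ℚ; 0ℚ; 1ℚ)
import Data.Rational.Properties as ℚP
open import Data.Rational.Solver using (module +-*-Solver)
open import Data.Sum using (_⊎_; inj₁; inj₂; [_,_]′; map₁)
open import Data.Vec using (_∷_; here; there)
open import Function using (_∘_)
open import Relation.Binary.PropositionalEquality
open import Relation.Nullary using (¬_; Dec; yes; no)

open import Algebra.Properties.CommutativeMonoid.Mult ℚP.+-0-commutativeMonoid
  using (×-distrib-+) renaming (_×_ to _·_)
open +-*-Solver using (solve; _:=_; _:+_; _:-_)

m∸n≤1+m∸[1+n] : ∀ m n → m ∸ n ≤ suc (m ∸ suc n)
m∸n≤1+m∸[1+n] zero    zero    = z≤n
m∸n≤1+m∸[1+n] zero    (suc n) = z≤n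
m∸n≤1+m∸[1+n] (suc m) zero    = ℕP.≤-refl
m∸n≤1+m∸[1+n] (suc m) (suc n) = m∸n≤1+m∸[1+n] m n

n*[m∸o]≤n+n*[m∸1+o] : ∀ n m o → n * (m ∸ o) ≤ n + n * (m ∸ suc o)
n*[m∸o]≤n+n*[m∸1+o] n m o =
  ℕP.≤-trans (ℕP.*-monoʳ-≤ n (m∸n≤1+m∸[1+n] m o)) (ℕP.≤-reflexive (ℕP.*-suc n (m ∸ suc o)))

m≤ceilDiv[m,n]*n : ∀ m n .{{_ : NonZero n}} → m ≤ ceilDiv m n * n
m≤ceilDiv[m,n]*n m (suc n) = ℕP.+-cancelʳ-≤ n m (q * suc n) (begin
  m + n                        ≡⟨ m≡m%n+[m/n]*n (m + n) (suc n) ⟩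
  (m + n) % suc n + q * suc n  ≤⟨ ℕP.+-monoˡ-≤ (q * suc n) (ℕP.≤-pred (m%n<n (m + n) (suc n))) ⟩
  n + q * suc n                ≡⟨ ℕP.+-comm n (q * suc n) ⟩
  q * suc n + n                ∎)
  where
  q = (m + n) / suc n
  open ℕP.≤-Reasoning

%-≢-within : ∀ {n} .{{_ : NonZero n}} x d → 0 < d → d < n → (x + d) % n ≢ x % n
%-≢-within {n} x d 0<d d<n same = ℕP.>⇒≢ 0<d d≡0
  where
  open ≡-Reasoning
  q = x / n
  q′ = (x + d) / n
  r = x % n
  shifted : r + (d + q * n) ≡ r + q′ * n
  shifted = begin
    r + (d + q * n)           ≡⟨ sym (ℕP.+-assoc r d (q * n)) ⟩
    r + d + q * n             ≡⟨ cong (_+ q * n) (ℕP.+-comm r d) ⟩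
    d + r + q * n             ≡⟨ ℕP.+-assoc d r (q * n) ⟩
    d + (r + q * n)           ≡⟨ cong (d +_) (sym (m≡m%n+[m/n]*n x n)) ⟩
    d + x                     ≡⟨ ℕP.+-comm d x ⟩
    x + d                     ≡⟨ m≡m%n+[m/n]*n (x + d) n ⟩
    (x + d) % n + q′ * n      ≡⟨ cong (_+ q′ * n) same ⟩
    r + q′ * n                ∎
  d≡0 : d ≡ 0
  d≡0 = begin
    d                 ≡⟨ sym (m<n⇒m%n≡m d<n) ⟩
    d % n             ≡⟨ sym ([m+kn]%n≡m%n d q n) ⟩
    (d + q * n) % n   ≡⟨ cong (_% n) (ℕP.+-cancelˡ-≡ r _ _ shifted) ⟩
    q′ * n % n        ≡⟨ m*n%n≡0 q′ n ⟩
    0                 ∎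

turnAgent-window : ∀ n x {j e} → j < e → e < n → turnAgent n (x + j) ≢ turnAgent n (x + e)
turnAgent-window (suc n) x {j} {e} j<e e<n same =
  %-≢-within (x + j) (e ∸ j) (ℕP.m<n⇒0<n∸m j<e) (ℕP.≤-<-trans (ℕP.m∸n≤m e j) e<n)
    (trans (cong (_% suc n) x+j+[e∸j]≡x+e) (sym same))
  where
  x+j+[e∸j]≡x+e : x + j + (e ∸ j) ≡ x + e
  x+j+[e∸j]≡x+e = trans (ℕP.+-assoc x j (e ∸ j)) (cong (x +_) (ℕP.m+[n∸m]≡n (ℕP.<⇒≤ j<e)))

p≤q⇒0≤q-p : ∀ {p q} → p ℚ.≤ q → 0ℚ ℚ.≤ q ℚ.- p
p≤q⇒0≤q-p {p} {q} p≤q = subst (ℚ._≤ q ℚ.- p) (ℚP.+-inverseʳ p) (ℚP.+-monoˡ-≤ (ℚ.- p) p≤q)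

p≤p+q : ∀ p {q} → 0ℚ ℚ.≤ q → p ℚ.≤ p ℚ.+ q
p≤p+q p {q} 0≤q = subst (ℚ._≤ p ℚ.+ q) (ℚP.+-identityʳ p) (ℚP.+-monoʳ-≤ p 0≤q)

·-nonNeg : ∀ n {p} → 0ℚ ℚ.≤ p → 0ℚ ℚ.≤ n · p
·-nonNeg zero    _   = ℚP.≤-refl
·-nonNeg (suc n) 0≤p = ℚP.+-mono-≤ 0≤p (·-nonNeg n 0≤p)

·-telescope : ∀ n F a b → F ℚ.+ n · (F ℚ.- b) ℚ.+ n · (b ℚ.- a) ≡ F ℚ.+ n · (F ℚ.- a)
·-telescope n F a b = begin
  F ℚ.+ n · (F ℚ.- b) ℚ.+ n · (b ℚ.- a)     ≡⟨ ℚP.+-assoc F _ _ ⟩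
  F ℚ.+ (n · (F ℚ.- b) ℚ.+ n · (b ℚ.- a))   ≡⟨ cong (F ℚ.+_) (sym (×-distrib-+ (F ℚ.- b) (b ℚ.- a) n)) ⟩
  F ℚ.+ n · (F ℚ.- b ℚ.+ (b ℚ.- a))         ≡⟨ cong (λ z → F ℚ.+ n · z) (solve 3 (λ F a b → F :- b :+ (b :- a) := F :- a) refl F a b) ⟩
  F ℚ.+ n · (F ℚ.- a)                       ∎
  where open ≡-Reasoning

[1+n]/1≡1+n/1 : ∀ n → ℤ.+ suc n ℚ./ 1 ≡ 1ℚ ℚ.+ ℤ.+ n ℚ./ 1
[1+n]/1≡1+n/1 n = begin
  ℤ.+ suc n ℚ./ 1                              ≡⟨ ℚP./-cong (cong (ℤ._+_ ℤ.1ℤ) (sym (ℤP.*-identityʳ (ℤ.+ n)))) refl ⟩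
  (ℤ.+ 1 ℤ.* ℤ.+ 1 ℤ.+ ℤ.+ n ℤ.* ℤ.+ 1) ℚ./ 1  ≡⟨⟩
  1ℚ ℚ.+ ℚ.mkℚ (ℤ.+ n) 0 n⊥1                    ≡⟨ cong (1ℚ ℚ.+_) (sym (ℚP.normalize-coprime n⊥1)) ⟩
  1ℚ ℚ.+ ℤ.+ n ℚ./ 1                           ∎
  where
  open ≡-Reasoning
  n⊥1 = coprime-sym (1-coprimeTo n)

·≡/1* : ∀ n p → n · p ≡ (ℤ.+ n ℚ./ 1) ℚ.* p
·≡/1* zero    p = sym (ℚP.*-zeroˡ p)
·≡/1* (suc n) p = begin
  p ℚ.+ n · p                         ≡⟨ cong₂ ℚ._+_ (sym (ℚP.*-identityˡ p)) (·≡/1* n p) ⟩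
  1ℚ ℚ.* p ℚ.+ (ℤ.+ n ℚ./ 1) ℚ.* p    ≡⟨ sym (ℚP.*-distribʳ-+ p 1ℚ (ℤ.+ n ℚ./ 1)) ⟩
  (1ℚ ℚ.+ ℤ.+ n ℚ./ 1) ℚ.* p          ≡⟨ cong (ℚ._* p) (sym ([1+n]/1≡1+n/1 n)) ⟩
  (ℤ.+ suc n ℚ./ 1) ℚ.* p             ∎
  where open ≡-Reasoning

x∈p─q⇒x∉q : ∀ {n} {x : Fin n} {p q : Subset n} → x ∈ p ─ q → x ∉ q
x∈p─q⇒x∉q {p = true  ∷ _} {false ∷ _} (there x∈p─q) (there x∈q) = x∈p─q⇒x∉q x∈p─q x∈q
x∈p─q⇒x∉q {p = false ∷ _} {false ∷ _} (there x∈p─q) (there x∈q) = x∈p─q⇒x∉q x∈p─q x∈q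
x∈p─q⇒x∉q {p = _     ∷ _} {true  ∷ _} (there x∈p─q) (there x∈q) = x∈p─q⇒x∉q x∈p─q x∈q

x∈p-y⇒x≢y : ∀ {n} {x y : Fin n} {p : Subset n} → x ∈ p - y → x ≢ y
x∈p-y⇒x≢y {y = y} x∈p-y refl = x∈p─q⇒x∉q x∈p-y (x∈⁅x⁆ y)

∣p∪⁅x⁆∣≤1+∣p∣ : ∀ {n} (p : Subset n) x → ∣ p ∪ ⁅ x ⁆ ∣ ≤ suc ∣ p ∣
∣p∪⁅x⁆∣≤1+∣p∣ (true  ∷ p) 𝔽.zero    rewrite ∪-identityʳ p = ℕP.n≤1+n _
∣p∪⁅x⁆∣≤1+∣p∣ (false ∷ p) 𝔽.zero    rewrite ∪-identityʳ p = ℕP.≤-refl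
∣p∪⁅x⁆∣≤1+∣p∣ (true  ∷ p) (𝔽.suc x) = s≤s (∣p∪⁅x⁆∣≤1+∣p∣ p x)
∣p∪⁅x⁆∣≤1+∣p∣ (false ∷ p) (𝔽.suc x) = ∣p∪⁅x⁆∣≤1+∣p∣ p x

x∉p⇒∣p∪⁅x⁆∣≡1+∣p∣ : ∀ {n} {p : Subset n} {x} → x ∉ p → ∣ p ∪ ⁅ x ⁆ ∣ ≡ suc ∣ p ∣
x∉p⇒∣p∪⁅x⁆∣≡1+∣p∣ {p = true  ∷ p} {𝔽.zero}  x∉p = ⊥-elim (x∉p here)
x∉p⇒∣p∪⁅x⁆∣≡1+∣p∣ {p = false ∷ p} {𝔽.zero}  x∉p rewrite ∪-identityʳ p = refl
x∉p⇒∣p∪⁅x⁆∣≡1+∣p∣ {p = true  ∷ p} {𝔽.suc x} x∉p = cong suc (x∉p⇒∣p∪⁅x⁆∣≡1+∣p∣ (λ x∈p → x∉p (there x∈p)))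
x∉p⇒∣p∪⁅x⁆∣≡1+∣p∣ {p = false ∷ p} {𝔽.suc x} x∉p = x∉p⇒∣p∪⁅x⁆∣≡1+∣p∣ (λ x∈p → x∉p (there x∈p))

∣p∣≤0⇒Empty : ∀ {n} {p : Subset n} → ∣ p ∣ ≤ 0 → Empty p
∣p∣≤0⇒Empty ∣p∣≤0 (_ , x∈p) = ℕP.<⇒≱ (ℕP.≤-<-trans z≤n (x∈p⇒∣p-x∣<∣p∣ x∈p)) ∣p∣≤0

Empty⇒⊆ : ∀ {n} {p q : Subset n} → Empty p → p ⊆ q
Empty⇒⊆ empty x∈p = ⊥-elim (empty (_ , x∈p))

∪-least : ∀ {n} {p q r : Subset n} → p ⊆ r → q ⊆ r → p ∪ q ⊆ r
∪-least {p = p} {q} p⊆r q⊆r x∈p∪q = [ p⊆r , q⊆r ]′ (x∈p∪q⁻ p q x∈p∪q)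

p∪[q∩∁p]≡p∪q : ∀ {n} (p q : Subset n) → p ∪ (q ∩ ∁ p) ≡ p ∪ q
p∪[q∩∁p]≡p∪q p q = begin
  p ∪ (q ∩ ∁ p)         ≡⟨ ∪-distribˡ-∩ p q (∁ p) ⟩
  (p ∪ q) ∩ (p ∪ ∁ p)   ≡⟨ cong ((p ∪ q) ∩_) (∪-inverseʳ p) ⟩
  (p ∪ q) ∩ ⊤           ≡⟨ ∩-identityʳ (p ∪ q) ⟩
  p ∪ q                 ∎
  where open ≡-Reasoning

p∪q⊆p∪[q-y]∪⁅y⁆ : ∀ {n} (p q : Subset n) y → p ∪ q ⊆ (p ∪ (q - y)) ∪ ⁅ y ⁆
p∪q⊆p∪[q-y]∪⁅y⁆ p q y {x} x∈p∪q with x∈p∪q⁻ p q x∈p∪q | x 𝔽.≟ y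
... | inj₁ x∈p | _        = p⊆p∪q ⁅ y ⁆ (p⊆p∪q (q - y) x∈p)
... | inj₂ _   | yes refl = q⊆p∪q (p ∪ (q - y)) ⁅ y ⁆ (x∈⁅x⁆ y)
... | inj₂ x∈q | no x≢y   = p⊆p∪q ⁅ y ⁆ (q⊆p∪q p (q - y) (x∈p∧x≢y⇒x∈p-y x∈q x≢y))

y∉p⇒y∉p∪[q-y] : ∀ {n} {p : Subset n} q {y} → y ∉ p → y ∉ p ∪ (q - y)
y∉p⇒y∉p∪[q-y] {p = p} q {y} y∉p y∈ = [ y∉p , (λ y∈q-y → x∈p-y⇒x≢y y∈q-y refl) ]′ (x∈p∪q⁻ p (q - y) y∈)

drop-to-removeChoice : ∀ {m} (u : Maybe (Fin m)) {A O : Subset m} {y₀} → O ⊆ A → y₀ ∈ O →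
               ∃[ y ] y ∈ O × O - y ⊆ removeChoice u A
drop-to-removeChoice nothing {O = O} {y₀} O⊆A y₀∈O = y₀ , y₀∈O , λ x∈O-y₀ → O⊆A (p─q⊆p O ⁅ y₀ ⁆ x∈O-y₀)
drop-to-removeChoice (just z) {O = O} {y₀} O⊆A y₀∈O with z ∈? O
... | yes z∈O = z , z∈O , λ x∈O-z → x∈p∧x≢y⇒x∈p-y (O⊆A (p─q⊆p O ⁅ z ⁆ x∈O-z)) (x∈p-y⇒x≢y x∈O-z)
... | no  z∉O = y₀ , y₀∈O , λ x∈O-y₀ → let x∈O = p─q⊆p O ⁅ y₀ ⁆ x∈O-y₀ in
                  x∈p∧x≢y⇒x∈p-y (O⊆A x∈O) (λ { refl → z∉O x∈O })

removeChoice⊆ : ∀ {m} (u : Maybe (Fin m)) p → removeChoice u p ⊆ p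
removeChoice⊆ nothing  p x∈p = x∈p
removeChoice⊆ (just z) p x∈p-z = p─q⊆p p ⁅ z ⁆ x∈p-z

⊆addChoice : ∀ {m} (u : Maybe (Fin m)) p → p ⊆ addChoice u p
⊆addChoice nothing  p x∈p = x∈p
⊆addChoice (just z) p x∈p = p⊆p∪q ⁅ z ⁆ x∈p

removeChoice-addChoice-disjoint : ∀ {m} (u : Maybe (Fin m)) {Q S : Subset m} →
  (∀ {y} → y ∈ Q → y ∉ S) → ∀ {y} → y ∈ removeChoice u Q → y ∉ addChoice u S
removeChoice-addChoice-disjoint nothing  disjoint = disjoint
removeChoice-addChoice-disjoint (just z) {Q} {S} disjoint y∈Q-z y∈S∪z =
  [ disjoint (p─q⊆p Q ⁅ z ⁆ y∈Q-z) , (λ y∈z → x∈p-y⇒x≢y y∈Q-z (x∈⁅y⁆⇒x≡y z y∈z)) ]′ (x∈p∪q⁻ S ⁅ z ⁆ y∈S∪z)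

f[S∪⁅x⁆]≡fS+marg : ∀ {m} (f : SetFun m) S x → f (S ∪ ⁅ x ⁆) ≡ f S ℚ.+ marg f x S
f[S∪⁅x⁆]≡fS+marg f S x = solve 2 (λ a b → a := b :+ (a :- b)) refl (f (S ∪ ⁅ x ⁆)) (f S)

marg-nonNeg : ∀ {m} {f : SetFun m} → Monotone f → ∀ x S → 0ℚ ℚ.≤ marg f x S
marg-nonNeg mono x S = p≤q⇒0≤q-p (mono S (S ∪ ⁅ x ⁆) (p⊆p∪q ⁅ x ⁆))

submodular-drop : ∀ {m} {f : SetFun m} → Monotone f → Submodular f →
  ∀ {P T : Subset m} {y} → P ⊆ T → y ∉ T → ∀ O → f (T ∪ O) ℚ.≤ f (T ∪ (O - y)) ℚ.+ marg f y P
submodular-drop {f = f} mono submod {P} {T} {y} P⊆T y∉T O = begin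
  f (T ∪ O)                ≤⟨ mono _ _ (p∪q⊆p∪[q-y]∪⁅y⁆ T O y) ⟩
  f (U ∪ ⁅ y ⁆)            ≡⟨ f[S∪⁅x⁆]≡fS+marg f U y ⟩
  f U ℚ.+ marg f y U       ≤⟨ ℚP.+-monoʳ-≤ (f U) (submod P U y (⊆-trans P⊆T (p⊆p∪q (O - y))) (y∉p⇒y∉p∪[q-y] O y∉T)) ⟩
  f U ℚ.+ marg f y P       ∎
  where
  U = T ∪ (O - y)
  open ℚP.≤-Reasoning

module Run {m} (n : ℕ) (c : Choices m) (a : ℕ) where

  avail-anti : ∀ {x y} → x ≤ y → avail c y ⊆ avail c x
  avail-anti = go ∘ ℕP.≤⇒≤′
    where
    go : ∀ {x y} → x ≤′ y → avail c y ⊆ avail c x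
    go ≤′-refl                 z∈ = z∈
    go (≤′-step {y} x≤′y) z∈ = go x≤′y (removeChoice⊆ (c y) (avail c y) z∈)

  bundle-step : ∀ x → bundle n c a x ⊆ bundle n c a (suc x)
  bundle-step x with turnAgent n x ℕ.≟ a
  ... | yes _ = ⊆addChoice (c x) (bundle n c a x)
  ... | no  _ = λ z∈ → z∈

  bundle-mono : ∀ {x y} → x ≤ y → bundle n c a x ⊆ bundle n c a y
  bundle-mono = go ∘ ℕP.≤⇒≤′
    where
    go : ∀ {x y} → x ≤′ y → bundle n c a x ⊆ bundle n c a y
    go ≤′-refl                 z∈ = z∈
    go (≤′-step {y} x≤′y) z∈ = bundle-step y (go x≤′y z∈)

  bundle-own : ∀ {x} → turnAgent n x ≡ a → bundle n c a (suc x) ≡ addChoice (c x) (bundle n c a x)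
  bundle-own {x} own with turnAgent n x ℕ.≟ a
  ... | yes _     = refl
  ... | no  other = ⊥-elim (other own)

  bundle-other : ∀ {x} → turnAgent n x ≢ a → bundle n c a (suc x) ≡ bundle n c a x
  bundle-other {x} other with turnAgent n x ℕ.≟ a
  ... | yes own = ⊥-elim (other own)
  ... | no  _   = refl

  avail∉bundle : ∀ x {y} → y ∈ avail c x → y ∉ bundle n c a x
  avail∉bundle zero    _ = ∉⊥
  avail∉bundle (suc x) with turnAgent n x ℕ.≟ a
  ... | yes _ = removeChoice-addChoice-disjoint (c x) (avail∉bundle x)
  ... | no  _ = λ y∈ → avail∉bundle x (removeChoice⊆ (c x) (avail c x) y∈)

  bundle-skip : ∀ x e → (∀ {j} → j < e → turnAgent n (x + j) ≢ a) →
                bundle n c a (x + e) ≡ bundle n c a x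
  bundle-skip x zero    _     = cong (bundle n c a) (ℕP.+-identityʳ x)
  bundle-skip x (suc e) other = begin
    bundle n c a (x + suc e)    ≡⟨ cong (bundle n c a) (ℕP.+-suc x e) ⟩
    bundle n c a (suc (x + e))  ≡⟨ bundle-other (other (ℕP.n<1+n e)) ⟩
    bundle n c a (x + e)        ≡⟨ bundle-skip x e (λ j<e → other (ℕP.m<n⇒m<1+n j<e)) ⟩
    bundle n c a x              ∎
    where open ≡-Reasoning

  bundle-window : ∀ x e → e < n → turnAgent n (x + e) ≡ a → bundle n c a (x + e) ≡ bundle n c a x
  bundle-window x e e<n own = bundle-skip x e
    (λ j<e own-j → turnAgent-window n x j<e e<n (trans own-j (sym own)))

∣S∣<k⇒feasible : ∀ {m k} {S Q : Subset m} {y} → y ∈ Q → ∣ S ∣ < k → Feasible k S Q y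
∣S∣<k⇒feasible {S = S} {y = y} y∈Q ∣S∣<k = y∈Q , ℕP.≤-trans (∣p∪⁅x⁆∣≤1+∣p∣ S y) ∣S∣<k

module _ {m} (f : SetFun m) {k : ℕ} {S Q : Subset m} where

  greedyStep-≤k : ∀ {u : Maybe (Fin m)} → GreedyStep f k S Q u → ∣ S ∣ ≤ k → ∣ addChoice u S ∣ ≤ k
  greedyStep-≤k (inj₁ (_ , refl))                 ∣S∣≤k = ∣S∣≤k
  greedyStep-≤k (inj₂ (_ , refl , (_ , ≤k) , _)) _     = ≤k

  greedyStep-picks : ∀ {u : Maybe (Fin m)} {y} → GreedyStep f k S Q u → (∀ {z} → z ∈ Q → z ∉ S) →
                     Feasible k S Q y → ∣ addChoice u S ∣ ≡ suc ∣ S ∣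
  greedyStep-picks (inj₁ (infeasible , _))          _        feasible = ⊥-elim (infeasible _ feasible)
  greedyStep-picks (inj₂ (_ , refl , (g∈Q , _) , _)) disjoint _        = x∉p⇒∣p∪⁅x⁆∣≡1+∣p∣ (disjoint g∈Q)

module Greedy {m n₁ : ℕ} (a : ℕ) (a<n : a < suc n₁) (f : SetFun m) (k : ℕ)
  (mono : Monotone f) (submod : Submodular f) (c : Choices m)
  (greedy : FollowsGreedy (suc n₁) f k c a) where

  n : ℕ
  n = suc n₁

  open Run n c a

  R : ℕ
  R = ceilDiv m n

  turn : ℕ → ℕ
  turn r = r * n + a

  S Q : ℕ → Subset m
  S r = bundle n c a (turn r)
  Q r = avail c (turn r)

  T : Subset m
  T = bundle n c a (numTurns m n)

  F : ℚ
  F = f T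

  turn-own : ∀ r → turnAgent n (turn r) ≡ a
  turn-own r = trans (cong (_% n) (ℕP.+-comm (r * n) a)) (trans ([m+kn]%n≡m%n a r n) (m<n⇒m%n≡m a<n))

  turn-mono : ∀ {r r′} → r ≤ r′ → turn r ≤ turn r′
  turn-mono r≤r′ = ℕP.+-monoˡ-≤ a (ℕP.*-monoˡ-≤ n r≤r′)

  turn<numTurns : ∀ {r} → r < R → turn r < numTurns m n
  turn<numTurns {r} r<R = begin-strict
    r * n + a   <⟨ ℕP.+-monoʳ-< (r * n) a<n ⟩
    r * n + n   ≡⟨ ℕP.+-comm (r * n) n ⟩
    suc r * n   ≤⟨ ℕP.*-monoˡ-≤ n r<R ⟩
    R * n       ∎
    where open ℕP.≤-Reasoning

  turn-suc : ∀ r → turn (suc r) ≡ suc (turn r) + n₁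
  turn-suc r = cong suc (trans (ℕP.+-assoc n₁ (r * n) a) (ℕP.+-comm n₁ (turn r)))

  S-zero : S 0 ≡ ⊥
  S-zero = bundle-window 0 a a<n (turn-own 0)

  S-end : S R ≡ T
  S-end = bundle-window (R * n) a a<n (turn-own R)

  S-suc : ∀ r → S (suc r) ≡ addChoice (c (turn r)) (S r)
  S-suc r = begin
    bundle n c a (turn (suc r))       ≡⟨ cong (bundle n c a) (turn-suc r) ⟩
    bundle n c a (suc (turn r) + n₁)  ≡⟨ bundle-window (suc (turn r)) n₁ (ℕP.n<1+n n₁) own ⟩
    bundle n c a (suc (turn r))       ≡⟨ bundle-own (turn-own r) ⟩
    addChoice (c (turn r)) (S r)      ∎
    where
    open ≡-Reasoning
    own : turnAgent n (suc (turn r) + n₁) ≡ a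
    own = subst (λ x → turnAgent n x ≡ a) (turn-suc r) (turn-own (suc r))

  S⊆T : ∀ {r} → r ≤ R → S r ⊆ T
  S⊆T {r} r≤R = subst (S r ⊆_) S-end (bundle-mono (turn-mono r≤R))

  Q-anti : ∀ {r r′} → r ≤ r′ → Q r′ ⊆ Q r
  Q-anti = avail-anti ∘ turn-mono

  Q∉S : ∀ r {y} → y ∈ Q r → y ∉ S r
  Q∉S r = avail∉bundle (turn r)

  greedy-at : ∀ {r} → r < R → GreedyStep f k (S r) (Q r) (c (turn r))
  greedy-at {r} r<R = greedy (turn r) (turn<numTurns r<R) (turn-own r)

  ∣S∣≤k : ∀ r → r ≤ R → ∣ S r ∣ ≤ k
  ∣S∣≤k zero    _   rewrite S-zero | ∣⊥∣≡0 m = z≤n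
  ∣S∣≤k (suc r) r<R = subst (λ P → ∣ P ∣ ≤ k) (sym (S-suc r))
                        (greedyStep-≤k f (greedy-at r<R) (∣S∣≤k r (ℕP.<⇒≤ r<R)))

  ∣T∣≤k : ∣ T ∣ ≤ k
  ∣T∣≤k = subst (λ P → ∣ P ∣ ≤ k) S-end (∣S∣≤k R ℕP.≤-refl)

  all-picks : ∀ {y} → y ∈ Q R → ∣ T ∣ < k → ∀ r → r ≤ R → ∣ S r ∣ ≡ r
  all-picks _  _     zero    _   = trans (cong ∣_∣ S-zero) (∣⊥∣≡0 m)
  all-picks {y} y∈ ∣T∣<k (suc r) r<R = begin
    ∣ S (suc r) ∣                       ≡⟨ cong ∣_∣ (S-suc r) ⟩
    ∣ addChoice (c (turn r)) (S r) ∣    ≡⟨ greedyStep-picks f (greedy-at r<R) (Q∉S r) y-feasible ⟩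
    suc ∣ S r ∣                         ≡⟨ cong suc (all-picks y∈ ∣T∣<k r (ℕP.<⇒≤ r<R)) ⟩
    suc r                               ∎
    where
    open ≡-Reasoning
    y-feasible : Feasible k (S r) (Q r) y
    y-feasible = ∣S∣<k⇒feasible {S = S r} (Q-anti (ℕP.<⇒≤ r<R) y∈)
                   (ℕP.≤-<-trans (p⊆q⇒∣p∣≤∣q∣ (S⊆T (ℕP.<⇒≤ r<R))) ∣T∣<k)

  -- Runs in which the items run out while the agent still has room need no budget: nothing is
  -- available at the end, and the agent never skips a turn for lack of room.
  Exhausted : Set
  Exhausted = ∣ T ∣ < k × Empty (Q R)

  Budget : ℕ → Subset m → Set
  Budget b O = ∣ O ∣ ≤ b ⊎ Exhausted

  Bounded : ℕ → ℕ → ℚ → Set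
  Bounded x b Y = ∀ O → O ⊆ avail c x → O ⊆ ∁ T → Budget b O → f (T ∪ O) ℚ.≤ Y

  Charge : ℕ → ℚ → Set
  Charge x δ = ∀ {y} → y ∈ avail c x → y ∉ T → ∀ O → f (T ∪ O) ℚ.≤ f (T ∪ (O - y)) ℚ.+ δ

  Budget-drop : ∀ {b O y} → y ∈ O → Budget (suc b) O → Budget b (O - y)
  Budget-drop y∈O = map₁ (λ ∣O∣≤1+b → ℕP.≤-pred (ℕP.≤-trans (x∈p⇒∣p-x∣<∣p∣ y∈O) ∣O∣≤1+b))

  Bounded-weaken : ∀ {x} {b b′ Y Y′} → b ≤ b′ → Y′ ℚ.≤ Y → Bounded x b′ Y′ → Bounded x b Y
  Bounded-weaken b≤b′ Y′≤Y bounded O O⊆Q O⊆∁T budget =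
    ℚP.≤-trans (bounded O O⊆Q O⊆∁T (map₁ (λ ∣O∣≤b → ℕP.≤-trans ∣O∣≤b b≤b′) budget)) Y′≤Y

  Bounded-own-pick : ∀ {x g b Y} → c x ≡ just g → g ∈ T → Bounded (suc x) b Y → Bounded x b Y
  Bounded-own-pick {x} {g} picked g∈T bounded O O⊆Q O⊆∁T = bounded O O⊆Q′ O⊆∁T
    where
    O⊆Q′ : O ⊆ avail c (suc x)
    O⊆Q′ {w} w∈O = subst (λ u → w ∈ removeChoice u (avail c x)) (sym picked)
      (x∈p∧x≢y⇒x∈p-y (O⊆Q w∈O) (λ { refl → x∈∁p⇒x∉p (O⊆∁T w∈O) g∈T }))

  Bounded-other : ∀ {x} {b Y δ} → Charge x δ → 0ℚ ℚ.≤ δ →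
                  Bounded (suc x) b Y → Bounded x (suc b) (Y ℚ.+ δ)
  Bounded-other {x} {b} {Y} {δ} charge 0≤δ bounded O O⊆Q O⊆∁T budget with nonempty? O
  ... | no empty rewrite Empty-unique empty =
    ℚP.≤-trans (bounded ⊥ ⊥⊆ ⊥⊆ (inj₁ (subst (_≤ b) (sym (∣⊥∣≡0 m)) z≤n))) (p≤p+q Y 0≤δ)
  ... | yes (_ , y₀∈O) with drop-to-removeChoice (c x) O⊆Q y₀∈O
  ...   | y , y∈O , O-y⊆Q′ = begin
    f (T ∪ O)                ≤⟨ charge (O⊆Q y∈O) (x∈∁p⇒x∉p (O⊆∁T y∈O)) O ⟩
    f (T ∪ (O - y)) ℚ.+ δ    ≤⟨ ℚP.+-monoˡ-≤ δ (bounded (O - y) O-y⊆Q′ O-y⊆∁T (Budget-drop y∈O budget)) ⟩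
    Y ℚ.+ δ                  ∎
    where
    open ℚP.≤-Reasoning
    O-y⊆∁T : O - y ⊆ ∁ T
    O-y⊆∁T w∈ = O⊆∁T (p─q⊆p O ⁅ y ⁆ w∈)

  Bounded-others : ∀ e {x b Y δ} → Charge x δ → 0ℚ ℚ.≤ δ →
                   Bounded (x + e) b Y → Bounded x (e + b) (Y ℚ.+ e · δ)
  Bounded-others zero {x} {b} {Y} _ _ bounded =
    Bounded-weaken {x} ℕP.≤-refl (ℚP.≤-reflexive (sym (ℚP.+-identityʳ Y)))
      (subst (λ z → Bounded z b Y) (ℕP.+-identityʳ x) bounded)
  Bounded-others (suc e) {x} {b} {Y} {δ} charge 0≤δ bounded =
    Bounded-weaken {x} ℕP.≤-refl (ℚP.≤-reflexive reassoc)
      (Bounded-other {x} charge 0≤δ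
        (Bounded-others e {suc x} charge′ 0≤δ (subst (λ z → Bounded z b Y) (ℕP.+-suc x e) bounded)))
    where
    charge′ : Charge (suc x) δ
    charge′ y∈ = charge (removeChoice⊆ (c x) (avail c x) y∈)
    reassoc : Y ℚ.+ e · δ ℚ.+ δ ≡ Y ℚ.+ suc e · δ
    reassoc = trans (ℚP.+-assoc Y (e · δ) δ) (cong (Y ℚ.+_) (ℚP.+-comm (e · δ) δ))

  Invariant : ℕ → Set
  Invariant r = Bounded (turn r) (n₁ * (∣ T ∣ ∸ ∣ S r ∣)) (F ℚ.+ n₁ · (F ℚ.- f (S r)))

  empty-bounded : ∀ {r O} → r ≤ R → Empty O → f (T ∪ O) ℚ.≤ F ℚ.+ n₁ · (F ℚ.- f (S r))
  empty-bounded {r} {O} r≤R empty = begin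
    f (T ∪ O)                       ≤⟨ mono _ _ (∪-least (λ x∈T → x∈T) (Empty⇒⊆ empty)) ⟩
    F                               ≤⟨ p≤p+q F (·-nonNeg n₁ (p≤q⇒0≤q-p (mono _ _ (S⊆T r≤R)))) ⟩
    F ℚ.+ n₁ · (F ℚ.- f (S r))      ∎
    where open ℚP.≤-Reasoning

  no-budget : ∀ r {O : Subset m} → ∣ T ∣ ≤ ∣ S r ∣ → ∣ O ∣ ≤ n₁ * (∣ T ∣ ∸ ∣ S r ∣) → Empty O
  no-budget r {O} ∣T∣≤∣S∣ ∣O∣≤ = ∣p∣≤0⇒Empty
    (subst (∣ O ∣ ≤_) (trans (cong (n₁ *_) (ℕP.m≤n⇒m∸n≡0 ∣T∣≤∣S∣)) (ℕP.*-zeroʳ n₁)) ∣O∣≤)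

  invariant-end : Invariant R
  invariant-end O _   _ (inj₁ ∣O∣≤)       = empty-bounded ℕP.≤-refl
    (no-budget R (ℕP.≤-reflexive (cong ∣_∣ (sym S-end))) ∣O∣≤)
  invariant-end O O⊆Q _ (inj₂ (_ , none)) = empty-bounded ℕP.≤-refl
    (λ (y , y∈O) → none (y , O⊆Q y∈O))

  invariant-skip : ∀ {r} → r ≤ R → (∀ y → ¬ Feasible k (S r) (Q r) y) → Invariant r
  invariant-skip {r} r≤R infeasible O O⊆Q _ budget = empty-bounded r≤R (empty (∣ S r ∣ ℕ.<? k) budget)
    where
    empty : Dec (∣ S r ∣ < k) → Budget (n₁ * (∣ T ∣ ∸ ∣ S r ∣)) O → Empty O
    empty (yes ∣S∣<k) _                  (y , y∈O) = infeasible y (∣S∣<k⇒feasible {S = S r} (O⊆Q y∈O) ∣S∣<k)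
    empty (no  ∣S∣≮k) (inj₁ ∣O∣≤)         = no-budget r (ℕP.≤-trans ∣T∣≤k (ℕP.≮⇒≥ ∣S∣≮k)) ∣O∣≤
    empty (no  ∣S∣≮k) (inj₂ (∣T∣<k , _)) = ⊥-elim (∣S∣≮k (ℕP.≤-<-trans (p⊆q⇒∣p∣≤∣q∣ (S⊆T r≤R)) ∣T∣<k))

  greedy-charge : ∀ {r g} → r < R → Feasible k (S r) (Q r) g →
    (∀ y → Feasible k (S r) (Q r) y → marg f y (S r) ℚ.≤ marg f g (S r)) →
    Charge (turn r) (marg f g (S r))
  greedy-charge {r} {g} r<R (g∈Q , ∣S∪g∣≤k) best {y} y∈Q y∉T O = begin
    f (T ∪ O)                            ≤⟨ submodular-drop mono submod (S⊆T (ℕP.<⇒≤ r<R)) y∉T O ⟩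
    f (T ∪ (O - y)) ℚ.+ marg f y (S r)   ≤⟨ ℚP.+-monoʳ-≤ (f (T ∪ (O - y))) (best y y-feasible) ⟩
    f (T ∪ (O - y)) ℚ.+ marg f g (S r)   ∎
    where
    open ℚP.≤-Reasoning
    y-feasible : Feasible k (S r) (Q r) y
    y-feasible = ∣S∣<k⇒feasible {S = S r} y∈Q
      (subst (_≤ k) (x∉p⇒∣p∪⁅x⁆∣≡1+∣p∣ (Q∉S r g∈Q)) ∣S∪g∣≤k)

  invariant-pick : ∀ {r g} → r < R → c (turn r) ≡ just g → Feasible k (S r) (Q r) g →
    (∀ y → Feasible k (S r) (Q r) y → marg f y (S r) ℚ.≤ marg f g (S r)) →
    Invariant (suc r) → Invariant r
  invariant-pick {r} {g} r<R picked feasible@(g∈Q , _) best next =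
    Bounded-weaken {turn r} budget≤ (ℚP.≤-reflexive (·-telescope n₁ F (f (S r)) (f P)))
      (Bounded-own-pick {turn r} picked g∈T
        (Bounded-others n₁ {suc (turn r)} charge (marg-nonNeg mono g (S r)) next′))
    where
    P = S r ∪ ⁅ g ⁆
    S[1+r]≡P : S (suc r) ≡ P
    S[1+r]≡P = trans (S-suc r) (cong (λ u → addChoice u (S r)) picked)
    g∈T : g ∈ T
    g∈T = S⊆T r<R (subst (g ∈_) (sym S[1+r]≡P) (q⊆p∪q (S r) ⁅ g ⁆ (x∈⁅x⁆ g)))
    charge : Charge (suc (turn r)) (marg f g (S r))
    charge y∈ = greedy-charge r<R feasible best (removeChoice⊆ (c (turn r)) (Q r) y∈)
    next′ : Bounded (suc (turn r) + n₁) (n₁ * (∣ T ∣ ∸ ∣ P ∣)) (F ℚ.+ n₁ · (F ℚ.- f P))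
    next′ = subst₂ (λ x P → Bounded x (n₁ * (∣ T ∣ ∸ ∣ P ∣)) (F ℚ.+ n₁ · (F ℚ.- f P)))
              (turn-suc r) S[1+r]≡P next
    budget≤ : n₁ * (∣ T ∣ ∸ ∣ S r ∣) ≤ n₁ + n₁ * (∣ T ∣ ∸ ∣ P ∣)
    budget≤ = subst (λ s → n₁ * (∣ T ∣ ∸ ∣ S r ∣) ≤ n₁ + n₁ * (∣ T ∣ ∸ s))
                (sym (x∉p⇒∣p∪⁅x⁆∣≡1+∣p∣ (Q∉S r g∈Q))) (n*[m∸o]≤n+n*[m∸1+o] n₁ ∣ T ∣ ∣ S r ∣)

  invariant-step : ∀ {r} → r < R → Invariant (suc r) → Invariant r
  invariant-step r<R next with greedy-at r<R
  ... | inj₁ (infeasible , _)               = invariant-skip (ℕP.<⇒≤ r<R) infeasible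
  ... | inj₂ (_ , picked , feasible , best) = invariant-pick r<R picked feasible best next

  invariant : ∀ d r → r + d ≡ R → Invariant r
  invariant zero    r r+0≡R   = subst Invariant (trans (sym r+0≡R) (ℕP.+-identityʳ r)) invariant-end
  invariant (suc d) r r+1+d≡R = invariant-step (subst (r <_) r+1+d≡R (ℕP.m<m+n r (s≤s z≤n)))
    (invariant d (suc r) (trans (sym (ℕP.+-suc r d)) r+1+d≡R))

  initial-budget : .{{_ : NonZero n₁}} → ∀ O → ∣ O ∣ ≤ k → Budget (n₁ * ∣ T ∣) (O ∩ ∁ T)
  initial-budget O ∣O∣≤k with ∣ T ∣ ℕ.<? k | nonempty? (Q R)
  ... | no  ∣T∣≮k | _            = inj₁ (begin
    ∣ O ∩ ∁ T ∣    ≤⟨ ∣p∩q∣≤∣p∣ O (∁ T) ⟩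
    ∣ O ∣          ≤⟨ ∣O∣≤k ⟩
    k              ≤⟨ ℕP.≮⇒≥ ∣T∣≮k ⟩
    ∣ T ∣          ≤⟨ ℕP.m≤n*m ∣ T ∣ n₁ ⟩
    n₁ * ∣ T ∣     ∎)
    where open ℕP.≤-Reasoning
  ... | yes ∣T∣<k | no  none     = inj₂ (∣T∣<k , none)
  ... | yes ∣T∣<k | yes (_ , y∈) = inj₁ (begin
    ∣ O ∩ ∁ T ∣      ≤⟨ ∣p∩q∣≤∣q∣ O (∁ T) ⟩
    ∣ ∁ T ∣          ≡⟨ ∣∁p∣≡n∸∣p∣ T ⟩
    m ∸ ∣ T ∣        ≤⟨ ℕP.∸-monoˡ-≤ ∣ T ∣ (m≤ceilDiv[m,n]*n m n) ⟩
    R * n ∸ ∣ T ∣    ≡⟨ cong (R * n ∸_) ∣T∣≡R ⟩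
    R * n ∸ R        ≡⟨ cong (_∸ R) (ℕP.*-suc R n₁) ⟩
    R + R * n₁ ∸ R   ≡⟨ ℕP.m+n∸m≡n R (R * n₁) ⟩
    R * n₁           ≡⟨ ℕP.*-comm R n₁ ⟩
    n₁ * R           ≡⟨ cong (n₁ *_) (sym ∣T∣≡R) ⟩
    n₁ * ∣ T ∣       ∎)
    where
    open ℕP.≤-Reasoning
    ∣T∣≡R : ∣ T ∣ ≡ R
    ∣T∣≡R = trans (cong ∣_∣ (sym S-end)) (all-picks y∈ ∣T∣<k R ℕP.≤-refl)

  approximation : .{{_ : NonZero n₁}} → Normalized f → OptMinusBound f k (avail c a) n F
  approximation normalized O ∣O∣≤k O⊆M = begin
    f O                              ≤⟨ mono O (T ∪ O) (q⊆p∪q T O) ⟩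
    f (T ∪ O)                        ≡⟨ cong f (sym (p∪[q∩∁p]≡p∪q T O)) ⟩
    f (T ∪ (O ∩ ∁ T))                ≤⟨ invariant R 0 refl (O ∩ ∁ T) O∩∁T⊆Q (p∩q⊆q O (∁ T)) budget ⟩
    F ℚ.+ n₁ · (F ℚ.- f (S 0))       ≡⟨ cong (λ z → F ℚ.+ n₁ · (F ℚ.- z)) (trans (cong f S-zero) normalized) ⟩
    F ℚ.+ n₁ · (F ℚ.- 0ℚ)            ≡⟨ cong (λ z → F ℚ.+ n₁ · z) (ℚP.+-identityʳ F) ⟩
    n · F                            ≡⟨ ·≡/1* n F ⟩
    (ℤ.+ n ℚ./ 1) ℚ.* F              ∎
    where
    open ℚP.≤-Reasoning
    O∩∁T⊆Q : O ∩ ∁ T ⊆ Q 0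
    O∩∁T⊆Q x∈ = O⊆M (p∩q⊆p O (∁ T) x∈)
    budget : Budget (n₁ * (∣ T ∣ ∸ ∣ S 0 ∣)) (O ∩ ∁ T)
    budget = subst (λ s → Budget (n₁ * (∣ T ∣ ∸ s)) (O ∩ ∁ T))
               (sym (trans (cong ∣_∣ S-zero) (∣⊥∣≡0 m))) (initial-budget O ∣O∣≤k)

theorem3 : (n m : ℕ) → 2 ≤ n → (i : Fin n) → (f : SetFun m) → (k : ℕ) → 1 ≤ k →
    Normalized f → Nonnegative f → Monotone f → Submodular f →
    (c : Choices m) → ValidRun n c → FollowsGreedy n f k c (toℕ i) →
    OptMinusBound f k (avail c (toℕ i)) n (f (bundle n c (toℕ i) (numTurns m n)))
theorem3 _ m (s≤s (s≤s _)) i f k _ normalized _ mono submod c _ greedy =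
  Greedy.approximation (toℕ i) (toℕ<n i) f k mono submod c greedy normalized
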